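{- For every Klee-graph $G$, the graph $\mathcal{F}(G,\mathbb{Z}_2\times\mathbb{Z}_2)$ is connected.
   Context: Klee-graphs are defined recursively: $K_4$ is a Klee-graph, and if $H$ is a Klee-graph and $v$ is a vertex of $H$ with neighbors $u_1,u_2,u_3$, then the graph obtained by deleting $v$, adding three new pairwise adjacent vertices $v_1,v_2,v_3$, and adding the edges $u_iv_i$ for $1\le i\le 3$, is a Klee-graph. A $(\mathbb{Z}_2\times\mathbb{Z}_2)$-flow in $G$ is a map $f:E(G)\to\mathbb{Z}_2\times\mathbb{Z}_2$ such that at every vertex the sum of values on incident edges is $0$; it is nowhere-zero if no edge receives $00$. A cycle is a connected 2-regular subgraph. $\mathcal{F}(G,\mathbb{Z}_2\times\mathbb{Z}_2)$ is the graph whose vertices are the nowhere-zero $(\mathbb{Z}_2\times\mathbb{Z}_2)$-flows of $G$, two flows $f,g$ adjacent iff $\{e:(f-g)(e)\ne0\}$ is the edge set of a cycle. -}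

module Defs where

open import Data.Nat using (ℕ; zero; suc; _+_)
open import Data.Fin using (Fin; zero; suc; _≟_)
open import Data.Bool using (Bool; true; false; not; _xor_; if_then_else_)
open import Data.Product using (_×_; _,_; ∃; Σ)
open import Data.Sum using (_⊎_)
open import Relation.Nullary using (¬_; does)
open import Data.Product.Properties using (≡-dec)
import Data.Bool as B
open import Relation.Binary.PropositionalEquality using (_≡_; _≢_)

record Graph (n : ℕ) : Set where
  field
    adj     : Fin n → Fin n → Bool
    adj-sym : ∀ x y → adj x y ≡ adj y x
    adj-irr : ∀ x → adj x x ≡ false
open Graph public

Z22 : Set
Z22 = Bool × Bool

0z : Z22
0z = false , false

_⊕_ : Z22 → Z22 → Z22
(a , b) ⊕ (c , d) = (a xor c) , (b xor d)

Σz : ∀ {n} → (Fin n → Z22) → Z22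
Σz {zero}  f = 0z
Σz {suc n} f = f zero ⊕ Σz (λ i → f (suc i))

count : ∀ {n} → (Fin n → Bool) → ℕ
count {zero}  p = 0
count {suc n} p = (if p zero then 1 else 0) + count (λ i → p (suc i))

-- Since every element of Z₂×Z₂ is its own inverse, the
-- orientation of edges is irrelevant; a flow is a symmetric edge labelling
-- (value at non-edges fixed to 0) with zero sum at every vertex.

record Flow {n} (G : Graph n) : Set where
  field
    val      : Fin n → Fin n → Z22
    val-sym  : ∀ x y → val x y ≡ val y x
    val-off  : ∀ x y → adj G x y ≡ false → val x y ≡ 0z
    conserve : ∀ x → Σz (λ y → val x y) ≡ 0z
open Flow public

NowhereZero : ∀ {n} {G : Graph n} → Flow G → Set
NowhereZero {G = G} f = ∀ x y → adj G x y ≡ true → val f x y ≢ 0z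

-- Cycles: an edge set S ⊆ E(G) (symmetric Bool relation) is the edge set
-- of a cycle iff the subgraph it spans is nonempty, 2-regular (every
-- vertex has S-degree 0 or 2) and connected (any two vertices of positive
-- S-degree are joined by a walk using edges of S).

data Walk {n} (S : Fin n → Fin n → Bool) : Fin n → Fin n → Set where
  here : ∀ {x} → Walk S x x
  step : ∀ {x y z} → S x y ≡ true → Walk S y z → Walk S x z

deg : ∀ {n} → (Fin n → Fin n → Bool) → Fin n → ℕ
deg S x = count (S x)

record IsCycleEdgeSet {n} (G : Graph n) (S : Fin n → Fin n → Bool) : Set where
  field
    sub       : ∀ x y → S x y ≡ true → adj G x y ≡ true
    symm      : ∀ x y → S x y ≡ S y x
    nonempty  : ∃ λ x → ∃ λ y → S x y ≡ true
    two-reg   : ∀ x → deg S x ≡ 0 ⊎ deg S x ≡ 2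
    connected : ∀ x y → deg S x ≢ 0 → deg S y ≢ 0 → Walk S x y

-- support of f - g (= f + g in Z₂×Z₂)
diffSupport : ∀ {n} {G : Graph n} → Flow G → Flow G → Fin n → Fin n → Bool
diffSupport f g x y = not (does (≡-dec B._≟_ B._≟_ (val f x y ⊕ val g x y) 0z))

NZFlow : ∀ {n} → Graph n → Set
NZFlow G = Σ (Flow G) NowhereZero

FAdj : ∀ {n} {G : Graph n} → NZFlow G → NZFlow G → Set
FAdj {G = G} (f , _) (g , _) = IsCycleEdgeSet G (diffSupport f g)

_≈F_ : ∀ {n} {G : Graph n} → NZFlow G → NZFlow G → Set
(f , _) ≈F (g , _) = ∀ x y → val f x y ≡ val g x y

data FPath {n} {G : Graph n} : NZFlow G → NZFlow G → Set where
  stop : ∀ {f g} → f ≈F g → FPath f g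
  move : ∀ {f h g} → FAdj f h → FPath h g → FPath f g

FlowGraphConnected : ∀ {n} → Graph n → Set
FlowGraphConnected G = ∀ (f g : NZFlow G) → FPath f g

-- Klee-graphs.  "G is obtained from H by replacing v by a triangle",
-- described up to isomorphism: ι embeds V(H) ∖ {v} into V(G), t₀,t₁,t₂
-- are the three new vertices, u₀,u₁,u₂ are the (exactly three, distinct)
-- neighbours of v in H, and adjacency in G is as prescribed.

record Truncation {m n} (H : Graph m) (v : Fin m) (G : Graph n) : Set where
  field
    u       : Fin 3 → Fin m
    u-inj   : ∀ i j → u i ≡ u j → i ≡ j
    u-nbr   : ∀ i → adj H v (u i) ≡ true
    u-all   : ∀ y → adj H v y ≡ true → ∃ λ i → u i ≡ y
    ι       : Fin m → Fin n
    ι-inj   : ∀ x y → x ≢ v → y ≢ v → ι x ≡ ι y → x ≡ y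
    t       : Fin 3 → Fin n
    t-inj   : ∀ i j → t i ≡ t j → i ≡ j
    ι≢t     : ∀ x i → x ≢ v → ι x ≢ t i
    cover   : ∀ w → (∃ λ x → x ≢ v × ι x ≡ w) ⊎ (∃ λ i → t i ≡ w)
    adj-ιι  : ∀ x y → x ≢ v → y ≢ v → adj G (ι x) (ι y) ≡ adj H x y
    adj-tt  : ∀ i j → adj G (t i) (t j) ≡ not (does (i ≟ j))
    adj-ιt₁ : ∀ x i → x ≢ v → adj G (ι x) (t i) ≡ true → x ≡ u i
    adj-ιt₂ : ∀ x i → x ≢ v → x ≡ u i → adj G (ι x) (t i) ≡ true

data IsKlee : ∀ {n} → Graph n → Set where
  k4    : ∀ {n} (G : Graph n) → n ≡ 4 →
          (∀ x y → adj G x y ≡ not (does (x ≟ y))) → IsKlee G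
  trunc : ∀ {m n} {H : Graph m} {G : Graph n} → IsKlee H →
          (v : Fin m) → Truncation H v G → IsKlee G

{-# OPTIONS --safe #-}
module Submission where

-- A nowhere-zero (Z₂×Z₂)-flow on a cubic graph is a proper 3-edge-colouring by the
-- three nonzero elements.  Klee-graphs are cubic, rigid (two such flows that agree on
-- the three edges at one vertex agree everywhere) and Kempe-connected (for every
-- colour c, the edges of the two other colours form a single cycle through all
-- vertices).  Exchanging those two colours is therefore a move in 𝓕(G, Z₂×Z₂), and
-- at most two exchanges make a flow agree with any given one at a fixed vertex,
-- hence everywhere.  K₄ has the three properties by inspection.  They survive
-- replacing a vertex v by a triangle, because contracting the triangle turns flows
-- of the new graph into flows of the old one: the triangle edges are coloured like
-- the opposite pendant edges, and the pendant edges carry the three colours at v.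

open import Level using (Level; 0ℓ)
open import Algebra.Bundles using (CommutativeMonoid)
import Algebra.Properties.CommutativeMonoid.Sum as MonoidSum
import Algebra.Properties.CommutativeSemigroup as CommutativeSemigroupProperties
open import Data.Bool using (Bool; true; false; not; _∧_; if_then_else_)
import Data.Bool as Bool
open import Data.Empty using (⊥; ⊥-elim)
open import Data.Fin using (Fin; zero; suc; _≟_; punchIn; punchOut)
open import Data.Fin.Patterns using (0F; 1F; 2F)
open import Data.Fin.Properties using (all?; any?; punchIn-injective; punchInᵢ≢i; punchIn-punchOut)
open import Data.Nat using (ℕ; _+_)
import Data.Nat as ℕ
open import Data.Nat.Properties using (+-0-commutativeMonoid)
open import Data.Product using (∃; ∃₂; _×_; _,_; proj₁; proj₂)
open import Data.Product.Properties using (≡-dec)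
open import Data.Sum using (_⊎_; inj₁; inj₂)
open import Data.Vec.Functional using (Vector; updateAt)
open import Data.Vec.Functional.Properties using (updateAt-updates; updateAt-minimal)
open import Function using (_∘_; const; case_of_)
open import Relation.Nullary using (Dec; yes; no; does)
open import Relation.Nullary.Decidable using (True; toWitness; map′; dec-false; _×-dec_; _⊎-dec_; _→-dec_)
open import Relation.Binary.PropositionalEquality
  using (_≡_; _≢_; refl; sym; trans; cong; cong₂; subst; subst₂; module ≡-Reasoning)
open import Relation.Binary.PropositionalEquality.Algebra using (isMagma)

open import Defs

infix 4 _≟z_

_≟z_ : (x y : Z22) → Dec (x ≡ y)
_≟z_ = ≡-dec Bool._≟_ Bool._≟_

instance
  Dec-Z22-≡ : {x y : Z22} → Dec (x ≡ y)
  Dec-Z22-≡ = _ ≟z _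

  Dec-Fin-≡ : ∀ {n} {i j : Fin n} → Dec (i ≡ j)
  Dec-Fin-≡ = _ ≟ _

  Dec-ℕ-≡ : {x y : ℕ} → Dec (x ≡ y)
  Dec-ℕ-≡ = _ ℕ.≟ _

  Dec-Bool-≡ : {x y : Bool} → Dec (x ≡ y)
  Dec-Bool-≡ = _ Bool.≟ _

  Dec-⊥ : Dec ⊥
  Dec-⊥ = no (λ ())

  Dec-→ : {A B : Set} → ⦃ Dec A ⦄ → ⦃ Dec B ⦄ → Dec (A → B)
  Dec-→ ⦃ a? ⦄ ⦃ b? ⦄ = a? →-dec b?

  Dec-⊎ : {A B : Set} → ⦃ Dec A ⦄ → ⦃ Dec B ⦄ → Dec (A ⊎ B)
  Dec-⊎ ⦃ a? ⦄ ⦃ b? ⦄ = a? ⊎-dec b?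

  Dec-× : {A B : Set} → ⦃ Dec A ⦄ → ⦃ Dec B ⦄ → Dec (A × B)
  Dec-× ⦃ a? ⦄ ⦃ b? ⦄ = a? ×-dec b?

  Dec-Fin-∀ : ∀ {n} {P : Fin n → Set} → ⦃ ∀ {i} → Dec (P i) ⦄ → Dec (∀ i → P i)
  Dec-Fin-∀ ⦃ p? ⦄ = all? (λ _ → p?)

  Dec-Fin-∃ : ∀ {n} {P : Fin n → Set} → ⦃ ∀ {i} → Dec (P i) ⦄ → Dec (∃ P)
  Dec-Fin-∃ ⦃ p? ⦄ = any? (λ _ → p?)

  Dec-Z22-∀ : {P : Z22 → Set} → ⦃ ∀ {z} → Dec (P z) ⦄ → Dec (∀ z → P z)
  Dec-Z22-∀ {P} ⦃ p? ⦄ = map′ every (λ h → h _ , h _ , h _ , h _) (p? ×-dec p? ×-dec p? ×-dec p?)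
    where
    every : P (false , false) × P (false , true) × P (true , false) × P (true , true) → ∀ z → P z
    every (p₀₀ , _ , _ , _) (false , false) = p₀₀
    every (_ , p₀₁ , _ , _) (false , true)  = p₀₁
    every (_ , _ , p₁₀ , _) (true , false)  = p₁₀
    every (_ , _ , _ , p₁₁) (true , true)   = p₁₁

decide : {A : Set} ⦃ a? : Dec A ⦄ → {True a?} → A
decide ⦃ a? ⦄ {t} = toWitness {a? = a?} t

⊕-assoc : ∀ x y z → (x ⊕ y) ⊕ z ≡ x ⊕ (y ⊕ z)
⊕-assoc = decide

⊕-comm : ∀ x y → x ⊕ y ≡ y ⊕ x
⊕-comm = decide

⊕-identityˡ : ∀ x → 0z ⊕ x ≡ x
⊕-identityˡ = decide

⊕-identityʳ : ∀ x → x ⊕ 0z ≡ x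
⊕-identityʳ = decide

⊕-commutativeMonoid : CommutativeMonoid 0ℓ 0ℓ
⊕-commutativeMonoid = record
  { isCommutativeMonoid = record
    { isMonoid = record
      { isSemigroup = record { isMagma = isMagma _⊕_ ; assoc = ⊕-assoc }
      ; identity = ⊕-identityˡ , ⊕-identityʳ
      }
    ; comm = ⊕-comm
    }
  }

x⊕[y⊕z]≡0⇒x≡y⊕z : ∀ x y z → x ⊕ (y ⊕ z) ≡ 0z → x ≡ y ⊕ z
x⊕[y⊕z]≡0⇒x≡y⊕z = decide

x⊕[y⊕z]≡0⇒y≢z : ∀ x y z → x ⊕ (y ⊕ z) ≡ 0z → x ≢ 0z → y ≢ z
x⊕[y⊕z]≡0⇒y≢z = decide

x≢y⇒x⊕y≢0 : ∀ x y → x ≢ y → x ⊕ y ≢ 0z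
x≢y⇒x⊕y≢0 = decide

distinct-nonzero⇒z≡x⊕y : ∀ x y z → x ≢ 0z → y ≢ 0z → z ≢ 0z →
                          x ≢ y → x ≢ z → y ≢ z → z ≡ x ⊕ y
distinct-nonzero⇒z≡x⊕y = decide

triangle-balance : ∀ p q r a b c →
                   p ⊕ (a ⊕ b) ≡ 0z → q ⊕ (a ⊕ c) ≡ 0z → r ⊕ (b ⊕ c) ≡ 0z → p ⊕ (q ⊕ r) ≡ 0z
triangle-balance = decide

-- For c ≠ 0, kempe c marks the two nonzero values other than c, and kempeSwap c
-- exchanges them.
kempe : Z22 → Z22 → Bool
kempe c z = not (does (z ≟z 0z)) ∧ not (does (z ≟z c))

kempeSwap : Z22 → Z22 → Z22
kempeSwap c z = if kempe c z then z ⊕ c else z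

kempeSwap-⊕ : ∀ c x y → kempeSwap c (x ⊕ y) ≡ kempeSwap c x ⊕ kempeSwap c y
kempeSwap-⊕ = decide

kempeSwap-nonzero : ∀ c z → z ≢ 0z → kempeSwap c z ≢ 0z
kempeSwap-nonzero = decide

kempeSwap-support : ∀ c z → c ≢ 0z → not (does (z ⊕ kempeSwap c z ≟z 0z)) ≡ kempe c z
kempeSwap-support = decide

kempeSwap-hit : ∀ a b → a ≢ 0z → b ≢ 0z → a ≢ b → kempeSwap (a ⊕ b) a ≡ b
kempeSwap-hit = decide

kempeSwap-fix : ∀ a b d → a ≢ 0z → b ≢ 0z → d ≢ 0z → d ≢ a → d ≢ b → kempeSwap (a ⊕ b) d ≡ d
kempeSwap-fix = decide

kempe-nonzero : ∀ c z → kempe c z ≡ true → z ≢ 0z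
kempe-nonzero = decide

kempe-other : ∀ c x y → x ≢ 0z → y ≢ 0z → x ≢ y → kempe c x ≡ false → kempe c y ≡ true
kempe-other = decide

kempe-count : ∀ c x y z → c ≢ 0z → x ≢ 0z → y ≢ 0z → z ≢ 0z → x ⊕ (y ⊕ z) ≡ 0z →
              (if kempe c x then 1 else 0) + ((if kempe c y then 1 else 0) + (if kempe c z then 1 else 0))
                ≡ 2
kempe-count = decide

module FiniteSum {c ℓ : Level} (M : CommutativeMonoid c ℓ) where
  open CommutativeMonoid M
    using ( Carrier; _≈_; _∙_; ε; ∙-cong; ∙-congˡ; identityˡ; identityʳ; reflexive; setoid
          ; commutativeSemigroup)
    renaming (sym to ≈-sym; trans to ≈-trans)
  open MonoidSum M using (sum; sum-cong-≋; sum-replicate-zero) public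
  open CommutativeSemigroupProperties commutativeSemigroup using (x∙yz≈y∙xz)
  open import Relation.Binary.Reasoning.Setoid setoid

  clear : ∀ {n} → Fin n → Vector Carrier n → Vector Carrier n
  clear a t = updateAt t a (const ε)

  sum-clear : ∀ {n} (t : Vector Carrier n) a → sum t ≈ t a ∙ sum (clear a t)
  sum-clear t zero    = ∙-congˡ (≈-sym (identityˡ _))
  sum-clear t (suc a) = begin
    t zero ∙ sum (t ∘ suc)                          ≈⟨ ∙-congˡ (sum-clear (t ∘ suc) a) ⟩
    t zero ∙ (t (suc a) ∙ sum (clear a (t ∘ suc)))  ≈⟨ x∙yz≈y∙xz _ _ _ ⟩
    t (suc a) ∙ (t zero ∙ sum (clear a (t ∘ suc)))  ∎

  sum-on-three : ∀ {n} (t : Vector Carrier n) {a b d} → a ≢ b → a ≢ d → b ≢ d →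
                 (∀ w → w ≢ a → w ≢ b → w ≢ d → t w ≈ ε) → sum t ≈ t a ∙ (t b ∙ t d)
  sum-on-three {n} t {a} {b} {d} a≢b a≢d b≢d outside = begin
    sum t                                ≈⟨ sum-clear t a ⟩
    t a ∙ sum t₁                         ≈⟨ ∙-congˡ (sum-clear t₁ b) ⟩
    t a ∙ (t₁ b ∙ sum t₂)                ≈⟨ ∙-congˡ (∙-congˡ (sum-clear t₂ d)) ⟩
    t a ∙ (t₁ b ∙ (t₂ d ∙ sum t₃))       ≈⟨ ∙-congˡ (∙-congˡ (∙-congˡ sum-t₃)) ⟩
    t a ∙ (t₁ b ∙ (t₂ d ∙ ε))            ≈⟨ ∙-congˡ (∙-cong (reflexive t₁b) (≈-trans (identityʳ _) (reflexive t₂d)))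
                                          ⟩
    t a ∙ (t b ∙ t d)                    ∎
    where
    t₁ = clear a t
    t₂ = clear b t₁
    t₃ = clear d t₂
    t₁b : t₁ b ≡ t b
    t₁b = updateAt-minimal b a t (a≢b ∘ sym)
    t₂d : t₂ d ≡ t d
    t₂d = trans (updateAt-minimal d b t₁ (b≢d ∘ sym)) (updateAt-minimal d a t (a≢d ∘ sym))
    keep-d : ∀ {w} → w ≢ d → t₃ w ≡ t₂ w
    keep-d {w} = updateAt-minimal w d t₂
    keep-b : ∀ {w} → w ≢ b → t₂ w ≡ t₁ w
    keep-b {w} = updateAt-minimal w b t₁
    t₃-vanishes : ∀ w → t₃ w ≈ ε
    t₃-vanishes w with w ≟ d | w ≟ b | w ≟ a
    ... | yes refl | _        | _        = reflexive (updateAt-updates w t₂)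
    ... | no w≢d   | yes refl | _        = reflexive (trans (keep-d w≢d) (updateAt-updates w t₁))
    ... | no w≢d   | no w≢b   | yes refl = reflexive (trans (keep-d w≢d) (trans (keep-b w≢b) (updateAt-updates w t)))
    ... | no w≢d   | no w≢b   | no w≢a   =
      ≈-trans (reflexive (trans (keep-d w≢d) (trans (keep-b w≢b) (updateAt-minimal w a t w≢a))))
              (outside w w≢a w≢b w≢d)
    sum-t₃ : sum t₃ ≈ ε
    sum-t₃ = ≈-trans (sum-cong-≋ t₃-vanishes) (sum-replicate-zero n)

module ⊕-Sum = FiniteSum ⊕-commutativeMonoid
module +-Sum = FiniteSum +-0-commutativeMonoid

Σz≡sum : ∀ {n} (h : Fin n → Z22) → Σz h ≡ ⊕-Sum.sum h
Σz≡sum {ℕ.zero}  h = refl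
Σz≡sum {ℕ.suc n} h = cong (h zero ⊕_) (Σz≡sum (h ∘ suc))

count≡sum : ∀ {n} (p : Fin n → Bool) → count p ≡ +-Sum.sum (λ i → if p i then 1 else 0)
count≡sum {ℕ.zero}  p = refl
count≡sum {ℕ.suc n} p = cong ((if p zero then 1 else 0) +_) (count≡sum (p ∘ suc))

count-cong : ∀ {n} {p q : Fin n → Bool} → (∀ i → p i ≡ q i) → count p ≡ count q
count-cong {ℕ.zero}  p≗q = refl
count-cong {ℕ.suc n} p≗q =
  cong₂ (λ b k → (if b then 1 else 0) + k) (p≗q zero) (count-cong (p≗q ∘ suc))

count≢0⇒∃ : ∀ {n} (p : Fin n → Bool) → count p ≢ 0 → ∃ λ i → p i ≡ true
count≢0⇒∃ {ℕ.zero}  p count≢0 = ⊥-elim (count≢0 refl)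
count≢0⇒∃ {ℕ.suc n} p count≢0 with p zero in p₀
... | true  = zero , p₀
... | false with i , pᵢ ← count≢0⇒∃ (p ∘ suc) count≢0 = suc i , pᵢ

Σz-kempeSwap : ∀ {n} c (h : Fin n → Z22) → Σz (kempeSwap c ∘ h) ≡ kempeSwap c (Σz h)
Σz-kempeSwap {ℕ.zero}  c h = refl
Σz-kempeSwap {ℕ.suc n} c h =
  trans (cong (kempeSwap c (h zero) ⊕_) (Σz-kempeSwap c (h ∘ suc)))
        (sym (kempeSwap-⊕ c (h zero) (Σz (h ∘ suc))))

module _ {n} (G : Graph n) where

  adj-flip : ∀ {x y} → adj G x y ≡ true → adj G y x ≡ true
  adj-flip {x} {y} xy = trans (adj-sym G y x) xy

  adj⇒≢ : ∀ {x y} → adj G x y ≡ true → x ≢ y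
  adj⇒≢ {x} xy refl with () ← trans (sym xy) (adj-irr G x)

_++_ : ∀ {n} {S : Fin n → Fin n → Bool} {x y z} → Walk S x y → Walk S y z → Walk S x z
here     ++ q = q
step s p ++ q = step s (p ++ q)

walk-mono : ∀ {n} {S S′ : Fin n → Fin n → Bool} → (∀ x y → S x y ≡ true → S′ x y ≡ true) →
            ∀ {x y} → Walk S x y → Walk S′ x y
walk-mono S⊆S′ here       = here
walk-mono S⊆S′ (step s p) = step (S⊆S′ _ _ s) (walk-mono S⊆S′ p)

AgreeAt : ∀ {n} {G : Graph n} → Flow G → Flow G → Fin n → Set
AgreeAt {n} f g x = ∀ (y : Fin n) → val f x y ≡ val g x y

kempeEdges : ∀ {n} {G : Graph n} → Flow G → Z22 → Fin n → Fin n → Bool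
kempeEdges f c x y = kempe c (val f x y)

diffSupport-sym : ∀ {n} {G : Graph n} (f g : Flow G) x y → diffSupport f g x y ≡ diffSupport f g y x
diffSupport-sym f g x y =
  cong₂ (λ a b → not (does (a ⊕ b ≟z 0z))) (val-sym f x y) (val-sym g x y)

-- Cubic graphs

record Neighbourhood {n} (G : Graph n) (x : Fin n) : Set where
  field
    nbr           : Fin 3 → Fin n
    nbr-injective : ∀ i j → nbr i ≡ nbr j → i ≡ j
    nbr-adjacent  : ∀ i → adj G x (nbr i) ≡ true
    nbr-complete  : ∀ y → adj G x y ≡ true → ∃ λ i → nbr i ≡ y

Cubic : ∀ {n} → Graph n → Set
Cubic {n} G = ∀ (x : Fin n) → Neighbourhood G x

fin3-exhausted : ∀ (i j k l : Fin 3) → i ≢ j → i ≢ k → j ≢ k → l ≡ i ⊎ l ≡ j ⊎ l ≡ k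
fin3-exhausted = decide

fin3-third : ∀ (i j : Fin 3) → ∃ λ k → k ≢ i × k ≢ j
fin3-third = decide

module NeighbourhoodProperties {n} {G : Graph n} {x : Fin n} (N : Neighbourhood G x) where
  open Neighbourhood N

  sum-around : ∀ {c ℓ} (M : CommutativeMonoid c ℓ) → let open CommutativeMonoid M in
               (t : Fin n → Carrier) → (∀ w → adj G x w ≡ false → t w ≈ ε) →
               ∀ i j k → i ≢ j → i ≢ k → j ≢ k →
               FiniteSum.sum M t ≈ t (nbr i) ∙ (t (nbr j) ∙ t (nbr k))
  sum-around M t off i j k i≢j i≢k j≢k = FiniteSum.sum-on-three M t
    (i≢j ∘ nbr-injective i j) (i≢k ∘ nbr-injective i k) (j≢k ∘ nbr-injective j k) outside
    where
    open CommutativeMonoid M using (_≈_; ε)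
    outside : ∀ w → w ≢ nbr i → w ≢ nbr j → w ≢ nbr k → t w ≈ ε
    outside w w≢i w≢j w≢k with adj G x w in xw
    ... | false = off w xw
    ... | true with nbr-complete w xw
    ... | l , refl with fin3-exhausted i j k l i≢j i≢k j≢k
    ... | inj₁ refl        = ⊥-elim (w≢i refl)
    ... | inj₂ (inj₁ refl) = ⊥-elim (w≢j refl)
    ... | inj₂ (inj₂ refl) = ⊥-elim (w≢k refl)

  Σz-around : (h : Fin n → Z22) → (∀ w → adj G x w ≡ false → h w ≡ 0z) →
              ∀ i j k → i ≢ j → i ≢ k → j ≢ k → Σz h ≡ h (nbr i) ⊕ (h (nbr j) ⊕ h (nbr k))
  Σz-around h off i j k i≢j i≢k j≢k =
    trans (Σz≡sum h) (sum-around ⊕-commutativeMonoid h off i j k i≢j i≢k j≢k)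

  kirchhoff : (f : Flow G) → ∀ i j k → i ≢ j → i ≢ k → j ≢ k →
              val f x (nbr i) ⊕ (val f x (nbr j) ⊕ val f x (nbr k)) ≡ 0z
  kirchhoff f i j k i≢j i≢k j≢k =
    trans (sym (Σz-around (val f x) (val-off f x) i j k i≢j i≢k j≢k)) (conserve f x)

  count-around : (p : Fin n → Bool) → (∀ w → adj G x w ≡ false → p w ≡ false) →
                 count p ≡ (if p (nbr 0F) then 1 else 0) +
                           ((if p (nbr 1F) then 1 else 0) + (if p (nbr 2F) then 1 else 0))
  count-around p off = trans (count≡sum p) (sum-around +-0-commutativeMonoid _
    (λ w xw → cong (λ b → if b then 1 else 0) (off w xw)) 0F 1F 2F (λ ()) (λ ()) (λ ()))

  colours-distinct : (f : Flow G) → NowhereZero f → ∀ i j → i ≢ j → val f x (nbr i) ≢ val f x (nbr j)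
  colours-distinct f nz i j i≢j with fin3-third i j
  ... | k , k≢i , k≢j =
    x⊕[y⊕z]≡0⇒y≢z _ _ _ (kirchhoff f k i j k≢i k≢j i≢j) (nz x (nbr k) (nbr-adjacent k))

  agree-around : (f g : Flow G) → (∀ i → val f x (nbr i) ≡ val g x (nbr i)) → AgreeAt f g x
  agree-around f g agree y with adj G x y in xy
  ... | false = trans (val-off f x y xy) (sym (val-off g x y xy))
  ... | true with nbr-complete y xy
  ... | i , refl = agree i

  position : Fin n → Fin 3
  position y with any? (λ i → nbr i ≟ y)
  ... | yes (i , _) = i
  ... | no _        = zero

  nbr-position : ∀ {y} → adj G x y ≡ true → nbr (position y) ≡ y
  nbr-position {y} xy with any? (λ i → nbr i ≟ y)
  ... | yes (_ , e) = e
  ... | no ∄i       = ⊥-elim (∄i (nbr-complete y xy))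

  position-nbr : ∀ i → position (nbr i) ≡ i
  position-nbr i = nbr-injective _ _ (nbr-position (nbr-adjacent i))

module Triangle {n} {G : Graph n} (cubic : Cubic G) (F : NZFlow G) where
  private
    f = proj₁ F
    nz = proj₂ F

  colours-distinct-at : ∀ {x y z} → adj G x y ≡ true → adj G x z ≡ true → y ≢ z → val f x y ≢ val f x z
  colours-distinct-at {x} {y} {z} xy xz y≢z
    with i , refl ← Neighbourhood.nbr-complete (cubic x) y xy
       | j , refl ← Neighbourhood.nbr-complete (cubic x) z xz =
    NeighbourhoodProperties.colours-distinct (cubic x) f nz i j (y≢z ∘ cong (Neighbourhood.nbr (cubic x)))

  triangle-colour : ∀ {x y z} → adj G x y ≡ true → adj G x z ≡ true → adj G y z ≡ true →
                    val f y z ≡ val f x y ⊕ val f x z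
  triangle-colour {x} {y} {z} xy xz yz =
    distinct-nonzero⇒z≡x⊕y _ _ _ (nz _ _ xy) (nz _ _ xz) (nz _ _ yz)
      (colours-distinct-at xy xz (adj⇒≢ G yz))
      (λ e → colours-distinct-at (adj-flip G xy) yz (adj⇒≢ G xz) (trans (val-sym f y x) e))
      (λ e → colours-distinct-at (adj-flip G xz) (adj-flip G yz) (adj⇒≢ G xy)
               (trans (val-sym f z x) (trans e (val-sym f y z))))

  triangle-walk : ∀ c {x y z} → adj G x y ≡ true → adj G x z ≡ true → adj G y z ≡ true →
                  Walk (kempeEdges f c) x y
  triangle-walk c {x} {y} {z} xy xz yz with kempe c (val f x y) in k
  ... | true  = step k here
  ... | false = step xz-in (step zy-in here)
    where
    xz-in : kempe c (val f x z) ≡ true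
    xz-in = kempe-other c _ _ (nz _ _ xy) (nz _ _ xz) (colours-distinct-at xy xz (adj⇒≢ G yz)) k
    zy-in : kempe c (val f z y) ≡ true
    zy-in = trans (cong (kempe c) (val-sym f z y))
      (kempe-other c _ _ (nz _ _ (adj-flip G xy)) (nz _ _ yz)
        (colours-distinct-at (adj-flip G xy) yz (adj⇒≢ G xz)) (trans (cong (kempe c) (val-sym f y x)) k))

-- Kempe swaps

kempeSwapFlow : ∀ {n} {G : Graph n} → Z22 → NZFlow G → NZFlow G
kempeSwapFlow c (f , nz) = record
  { val      = λ x y → kempeSwap c (val f x y)
  ; val-sym  = λ x y → cong (kempeSwap c) (val-sym f x y)
  ; val-off  = λ x y xy → cong (kempeSwap c) (val-off f x y xy)
  ; conserve = λ x → trans (Σz-kempeSwap c (val f x)) (cong (kempeSwap c) (conserve f x))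
  } , λ x y xy → kempeSwap-nonzero c _ (nz x y xy)

kempeSwap-adjacent : ∀ {n} {G : Graph n} → Cubic G → Fin n → (F : NZFlow G) → ∀ {c} → c ≢ 0z →
                     (∀ x y → Walk (kempeEdges (proj₁ F) c) x y) → FAdj F (kempeSwapFlow c F)
kempeSwap-adjacent {G = G} cubic x₀ F@(f , nz) {c} c≢0 connected = record
  { sub       = λ x y s → kempe⇒adj x y (trans (moved x y) s)
  ; symm      = diffSupport-sym f (proj₁ (kempeSwapFlow c F))
  ; nonempty  = x₀ , count≢0⇒∃ (D x₀) (λ deg≡0 → case trans (sym (degree-two x₀)) deg≡0 of λ ())
  ; two-reg   = λ x → inj₂ (degree-two x)
  ; connected = λ x y _ _ → walk-mono (λ a b s → trans (sym (moved a b)) s) (connected x y)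
  }
  where
  D = diffSupport f (proj₁ (kempeSwapFlow c F))

  moved : ∀ x y → kempeEdges f c x y ≡ D x y
  moved x y = sym (kempeSwap-support c (val f x y) c≢0)

  kempe⇒adj : ∀ x y → kempeEdges f c x y ≡ true → adj G x y ≡ true
  kempe⇒adj x y k with adj G x y in xy
  ... | true  = refl
  ... | false = ⊥-elim (kempe-nonzero c _ k (val-off f x y xy))

  degree-two : ∀ x → deg D x ≡ 2
  degree-two x = begin
    count (D x)                    ≡⟨ count-cong (moved x) ⟨
    count (kempeEdges f c x)       ≡⟨ count-around _ (λ w xw → cong (kempe c) (val-off f x w xw)) ⟩
    _                              ≡⟨ kempe-count c _ _ _ c≢0 (nonzero 0F) (nonzero 1F) (nonzero 2F)
                                        (kirchhoff f 0F 1F 2F (λ ()) (λ ()) (λ ())) ⟩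
    2                              ∎
    where
    open ≡-Reasoning
    open Neighbourhood (cubic x)
    open NeighbourhoodProperties (cubic x)
    nonzero : ∀ i → val f x (nbr i) ≢ 0z
    nonzero i = nz x (nbr i) (nbr-adjacent i)

Rigid : ∀ {n} → Graph n → Set
Rigid G = ∀ (F F′ : NZFlow G) x → AgreeAt (proj₁ F) (proj₁ F′) x → F ≈F F′

KempeConnected : ∀ {n} → Graph n → Set
KempeConnected G = ∀ (F : NZFlow G) c x y → Walk (kempeEdges (proj₁ F) c) x y

record KleeProperties {n} (G : Graph n) : Set where
  field
    cubic           : Cubic G
    rigid           : Rigid G
    kempe-connected : KempeConnected G

flowGraph-connected : ∀ {n} {G : Graph n} → KleeProperties G → FlowGraphConnected G
flowGraph-connected {ℕ.zero}  P F F′ = stop (λ ())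
flowGraph-connected {ℕ.suc n} {G} P F F′ = reach F
  where
  open KleeProperties P
  x₀ : Fin (ℕ.suc n)
  x₀ = zero
  open Neighbourhood (cubic x₀)
  open NeighbourhoodProperties (cubic x₀)

  colour : NZFlow G → Fin 3 → Z22
  colour (f , _) i = val f x₀ (nbr i)

  colour-nonzero : ∀ F i → colour F i ≢ 0z
  colour-nonzero (_ , nz) i = nz x₀ (nbr i) (nbr-adjacent i)

  colour-distinct : ∀ F i j → i ≢ j → colour F i ≢ colour F j
  colour-distinct (f , nz) = colours-distinct f nz

  swapped : NZFlow G → Fin 3 → NZFlow G
  swapped F i = kempeSwapFlow (colour F i ⊕ colour F′ i) F

  swap-towards : ∀ F i → colour F i ≢ colour F′ i → FAdj F (swapped F i)
  swap-towards F i ne = kempeSwap-adjacent cubic x₀ F (x≢y⇒x⊕y≢0 _ _ ne) (kempe-connected F _)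

  swap-hits : ∀ F i → colour F i ≢ colour F′ i → colour (swapped F i) i ≡ colour F′ i
  swap-hits F i ne = kempeSwap-hit _ _ (colour-nonzero F i) (colour-nonzero F′ i) ne

  reach-from-two : ∀ F → colour F 0F ≡ colour F′ 0F → colour F 1F ≡ colour F′ 1F →
                   FPath F F′
  reach-from-two F@(f , _) e₀ e₁ = stop (rigid F F′ x₀ (agree-around f (proj₁ F′) agree))
    where
    third : ∀ G → colour G 2F ≡ colour G 0F ⊕ colour G 1F
    third G@(g , _) = x⊕[y⊕z]≡0⇒x≡y⊕z (colour G 2F) (colour G 0F) (colour G 1F)
                        (kirchhoff g 2F 0F 1F (λ ()) (λ ()) (λ ()))
    agree : ∀ i → colour F i ≡ colour F′ i
    agree 0F = e₀
    agree 1F = e₁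
    agree 2F = trans (third F) (trans (cong₂ _⊕_ e₀ e₁) (sym (third F′)))

  reach-from-one : ∀ F → colour F 0F ≡ colour F′ 0F → FPath F F′
  reach-from-one F e₀ with colour F 1F ≟z colour F′ 1F
  ... | yes e₁ = reach-from-two F e₀ e₁
  ... | no ne  = move (swap-towards F 1F ne)
                      (reach-from-two (swapped F 1F) (trans fixed e₀) (swap-hits F 1F ne))
    where
    fixed : kempeSwap (colour F 1F ⊕ colour F′ 1F) (colour F 0F) ≡ colour F 0F
    fixed = kempeSwap-fix _ _ _ (colour-nonzero F 1F) (colour-nonzero F′ 1F) (colour-nonzero F 0F)
              (colour-distinct F 0F 1F (λ ()))
              (λ e → colour-distinct F′ 0F 1F (λ ()) (trans (sym e₀) e))

  reach : ∀ F → FPath F F′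
  reach F with colour F 0F ≟z colour F′ 0F
  ... | yes e₀ = reach-from-one F e₀
  ... | no ne  = move (swap-towards F 0F ne) (reach-from-one (swapped F 0F) (swap-hits F 0F ne))

-- K₄

module K4 (G : Graph 4) (complete : ∀ x y → adj G x y ≡ not (does (x ≟ y))) where

  adj-≢ : ∀ {x y} → x ≢ y → adj G x y ≡ true
  adj-≢ {x} {y} x≢y = trans (complete x y) (cong not (dec-false (x ≟ y) x≢y))

  cubic : Cubic G
  cubic x = record
    { nbr           = punchIn x
    ; nbr-injective = punchIn-injective x
    ; nbr-adjacent  = λ i → adj-≢ (punchInᵢ≢i x i ∘ sym)
    ; nbr-complete  = λ y xy → punchOut (adj⇒≢ G xy) , punchIn-punchOut (adj⇒≢ G xy)
    }

  avoid-two : ∀ (x y : Fin 4) → ∃ λ z → z ≢ x × z ≢ y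
  avoid-two = decide

  rigid : Rigid G
  rigid F@(f , _) F′@(f′ , _) x agree y z with y ≟ x | z ≟ x | y ≟ z
  ... | yes refl | _        | _        = agree z
  ... | no _     | yes refl | _        = trans (val-sym f y z) (trans (agree y) (val-sym f′ z y))
  ... | no _     | no _     | yes refl =
    trans (val-off f y y (adj-irr G y)) (sym (val-off f′ y y (adj-irr G y)))
  ... | no y≢x   | no z≢x   | no y≢z   = begin
    val f y z              ≡⟨ Triangle.triangle-colour cubic F xy xz yz ⟩
    val f x y ⊕ val f x z  ≡⟨ cong₂ _⊕_ (agree y) (agree z) ⟩
    val f′ x y ⊕ val f′ x z ≡⟨ Triangle.triangle-colour cubic F′ xy xz yz ⟨
    val f′ y z             ∎
    where
    open ≡-Reasoning
    xy = adj-≢ (y≢x ∘ sym)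
    xz = adj-≢ (z≢x ∘ sym)
    yz = adj-≢ y≢z

  kempe-connected : KempeConnected G
  kempe-connected F c x y with x ≟ y
  ... | yes refl = here
  ... | no x≢y with z , z≢x , z≢y ← avoid-two x y =
    Triangle.triangle-walk cubic F c (adj-≢ x≢y) (adj-≢ (z≢x ∘ sym)) (adj-≢ (z≢y ∘ sym))

  properties : KleeProperties G
  properties = record { cubic = cubic ; rigid = rigid ; kempe-connected = kempe-connected }

-- Replacing a vertex by a triangle

module Truncate {m n} {H : Graph m} {v : Fin m} {G : Graph n} (T : Truncation H v G) where
  open Truncation T

  v-nbhd : Neighbourhood H v
  v-nbhd = record { nbr = u ; nbr-injective = u-inj ; nbr-adjacent = u-nbr ; nbr-complete = u-all }

  open NeighbourhoodProperties v-nbhd using (position; nbr-position; position-nbr)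

  u≢v : ∀ i → u i ≢ v
  u≢v i = adj⇒≢ H (u-nbr i) ∘ sym

  -- The edge yz of H is the edge of G from end y z to end z y; at v it ends in the
  -- triangle vertex t i with u i = z.
  end : Fin m → Fin m → Fin n
  end y z with y ≟ v
  ... | yes _ = t (position z)
  ... | no _  = ι y

  end-v : ∀ z → end v z ≡ t (position z)
  end-v z with v ≟ v
  ... | yes _  = refl
  ... | no v≢v = ⊥-elim (v≢v refl)

  end-ι : ∀ {y} z → y ≢ v → end y z ≡ ι y
  end-ι {y} z y≢v with y ≟ v
  ... | yes y≡v = ⊥-elim (y≢v y≡v)
  ... | no _    = refl

  end-u : ∀ i → end v (u i) ≡ t i
  end-u i = trans (end-v (u i)) (cong t (position-nbr i))

  adj-t-ι : ∀ {z} → z ≢ v → adj G (t (position z)) (ι z) ≡ adj H v z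
  adj-t-ι {z} z≢v with adj H v z in vz
  ... | true = adj-flip G (adj-ιt₂ z (position z) z≢v (sym (nbr-position vz)))
  ... | false with adj G (t (position z)) (ι z) in tz
  ...   | false = refl
  ...   | true with () ← trans (sym vz) (trans (cong (adj H v) (adj-ιt₁ z _ z≢v (adj-flip G tz)))
                                              (u-nbr _))

  adj-end : ∀ y z → adj G (end y z) (end z y) ≡ adj H y z
  adj-end y z with y ≟ v | z ≟ v
  ... | yes refl | yes refl = trans (adj-irr G _) (sym (adj-irr H v))
  ... | yes refl | no z≢v   = adj-t-ι z≢v
  ... | no y≢v   | yes refl = trans (adj-sym G _ _) (trans (adj-t-ι y≢v) (adj-sym H v y))
  ... | no y≢v   | no z≢v   = adj-ιι y z y≢v z≢v

  end-injective : ∀ {a b} y → end a y ≡ end b y → a ≡ b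
  end-injective {a} {b} y e with a ≟ v | b ≟ v
  ... | yes refl | yes refl = refl
  ... | yes refl | no b≢v   = ⊥-elim (ι≢t b _ b≢v (sym e))
  ... | no a≢v   | yes refl = ⊥-elim (ι≢t a _ a≢v e)
  ... | no a≢v   | no b≢v   = ι-inj a b a≢v b≢v e

  end-covers : ∀ w → ∃₂ λ y z → end y z ≡ w
  end-covers w with cover w
  ... | inj₁ (x , x≢v , refl) = x , x , end-ι x x≢v
  ... | inj₂ (i , refl)       = v , u i , end-u i

  ι-nbhd : ∀ {y} → y ≢ v → Neighbourhood H y → Neighbourhood G (ι y)
  ι-nbhd {y} y≢v N = record
    { nbr           = λ k → end (nbr k) y
    ; nbr-injective = λ i j e → nbr-injective i j (end-injective y e)
    ; nbr-adjacent  = λ k → trans (adj-at-ι (nbr k)) (nbr-adjacent k)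
    ; nbr-complete  = complete
    }
    where
    open Neighbourhood N
    adj-at-ι : ∀ z → adj G (ι y) (end z y) ≡ adj H y z
    adj-at-ι z = trans (cong (λ w → adj G w (end z y)) (sym (end-ι z y≢v))) (adj-end y z)
    end-at-ι : ∀ {w} → adj G (ι y) w ≡ true → ∃ λ z → end z y ≡ w
    end-at-ι {w} yw with cover w
    ... | inj₁ (z , z≢v , refl) = z , end-ι y z≢v
    ... | inj₂ (i , refl)       =
      v , trans (end-v y) (cong t (trans (cong position (adj-ιt₁ y i y≢v yw)) (position-nbr i)))
    complete : ∀ w → adj G (ι y) w ≡ true → ∃ λ k → end (nbr k) y ≡ w
    complete w yw with z , refl ← end-at-ι yw
                  with k , refl ← nbr-complete z (trans (sym (adj-at-ι z)) yw) = k , refl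

  corner : Fin 3 → Fin 3 → Fin n
  corner i k with k ≟ i
  ... | yes _ = ι (u i)
  ... | no _  = t k

  corner-self : ∀ i → corner i i ≡ ι (u i)
  corner-self i with i ≟ i
  ... | yes _  = refl
  ... | no i≢i = ⊥-elim (i≢i refl)

  corner-other : ∀ {i k} → k ≢ i → corner i k ≡ t k
  corner-other {i} {k} k≢i with k ≟ i
  ... | yes k≡i = ⊥-elim (k≢i k≡i)
  ... | no _    = refl

  adj-t-t : ∀ {i j} → i ≢ j → adj G (t i) (t j) ≡ true
  adj-t-t {i} {j} i≢j = trans (adj-tt i j) (cong not (dec-false (i ≟ j) i≢j))

  t-nbhd : ∀ i → Neighbourhood G (t i)
  t-nbhd i = record
    { nbr           = corner i
    ; nbr-injective = injective
    ; nbr-adjacent  = adjacent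
    ; nbr-complete  = complete
    }
    where
    injective : ∀ k l → corner i k ≡ corner i l → k ≡ l
    injective k l e with k ≟ i | l ≟ i
    ... | yes refl | yes refl = refl
    ... | yes refl | no _     = ⊥-elim (ι≢t (u k) l (u≢v k) e)
    ... | no _     | yes refl = ⊥-elim (ι≢t (u l) k (u≢v l) (sym e))
    ... | no _     | no _     = t-inj k l e
    adjacent : ∀ k → adj G (t i) (corner i k) ≡ true
    adjacent k with k ≟ i
    ... | yes refl = adj-flip G (adj-ιt₂ (u k) k (u≢v k) refl)
    ... | no k≢i   = adj-t-t (k≢i ∘ sym)
    complete : ∀ w → adj G (t i) w ≡ true → ∃ λ k → corner i k ≡ w
    complete w tw with cover w
    ... | inj₁ (z , z≢v , refl) =
      i , trans (corner-self i) (cong ι (sym (adj-ιt₁ z i z≢v (adj-flip G tw))))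
    ... | inj₂ (j , refl)       = j , corner-other (λ j≡i → adj⇒≢ G tw (cong t (sym j≡i)))

  cubic-preserved : Cubic H → Cubic G
  cubic-preserved cubicH w with cover w
  ... | inj₁ (x , x≢v , refl) = ι-nbhd x≢v (cubicH x)
  ... | inj₂ (i , refl)       = t-nbhd i

  pendant : Flow G → Fin 3 → Z22
  pendant f i = val f (t i) (ι (u i))

  kirchhoff-at-t : ∀ f k i j → k ≢ i → k ≢ j → i ≢ j →
                   pendant f k ⊕ (val f (t k) (t i) ⊕ val f (t k) (t j)) ≡ 0z
  kirchhoff-at-t f k i j k≢i k≢j i≢j = begin
    pendant f k ⊕ (val f (t k) (t i) ⊕ val f (t k) (t j))
      ≡⟨ cong₂ (λ a b → val f (t k) a ⊕ b) (corner-self k)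
           (cong₂ (λ a b → val f (t k) a ⊕ val f (t k) b)
                  (corner-other (k≢i ∘ sym)) (corner-other (k≢j ∘ sym))) ⟨
    val f (t k) (corner k k) ⊕ (val f (t k) (corner k i) ⊕ val f (t k) (corner k j))
      ≡⟨ NeighbourhoodProperties.kirchhoff (t-nbhd k) f k i j k≢i k≢j i≢j ⟩
    0z ∎
    where open ≡-Reasoning

  pendants-sum-zero : ∀ f → pendant f 0F ⊕ (pendant f 1F ⊕ pendant f 2F) ≡ 0z
  pendants-sum-zero f = triangle-balance (pendant f 0F) (pendant f 1F) (pendant f 2F) a b c
    (kirchhoff-at-t f 0F 1F 2F (λ ()) (λ ()) (λ ()))
    (subst (λ x → pendant f 1F ⊕ (x ⊕ c) ≡ 0z) (val-sym f _ _)
      (kirchhoff-at-t f 1F 0F 2F (λ ()) (λ ()) (λ ())))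
    (subst₂ (λ x y → pendant f 2F ⊕ (x ⊕ y) ≡ 0z) (val-sym f _ _) (val-sym f _ _)
      (kirchhoff-at-t f 2F 0F 1F (λ ()) (λ ()) (λ ())))
    where
    a = val f (t 0F) (t 1F)
    b = val f (t 0F) (t 2F)
    c = val f (t 1F) (t 2F)

  module Contraction (cubicH : Cubic H) where
    cubicG : Cubic G
    cubicG = cubic-preserved cubicH

    contractVal : Flow G → Fin m → Fin m → Z22
    contractVal f y z = val f (end y z) (end z y)

    contract-off : ∀ f y z → adj H y z ≡ false → contractVal f y z ≡ 0z
    contract-off f y z yz = val-off f _ _ (trans (adj-end y z) yz)

    contract-at-v : ∀ f i → contractVal f v (u i) ≡ pendant f i
    contract-at-v f i = cong₂ (val f) (end-u i) (end-ι v (u≢v i))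

    contract-at-ι : ∀ f {y} z → y ≢ v → contractVal f y z ≡ val f (ι y) (end z y)
    contract-at-ι f z y≢v = cong (λ w → val f w (end z _)) (end-ι z y≢v)

    conserve-at-v : ∀ f → Σz (contractVal f v) ≡ 0z
    conserve-at-v f = begin
      Σz (contractVal f v)
        ≡⟨ Σz-around v-nbhd (contractVal f v) (contract-off f v) 0F 1F 2F (λ ()) (λ ()) (λ ()) ⟩
      contractVal f v (u 0F) ⊕ (contractVal f v (u 1F) ⊕ contractVal f v (u 2F))
        ≡⟨ cong₂ _⊕_ (contract-at-v f 0F) (cong₂ _⊕_ (contract-at-v f 1F) (contract-at-v f 2F)) ⟩
      pendant f 0F ⊕ (pendant f 1F ⊕ pendant f 2F)
        ≡⟨ pendants-sum-zero f ⟩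
      0z ∎
      where open ≡-Reasoning
            open NeighbourhoodProperties using (Σz-around)

    conserve-at-ι : ∀ f {y} → y ≢ v → Σz (contractVal f y) ≡ 0z
    conserve-at-ι f {y} y≢v = begin
      Σz (contractVal f y)
        ≡⟨ Σz-around (cubicH y) (contractVal f y) (contract-off f y) 0F 1F 2F (λ ()) (λ ()) (λ ()) ⟩
      contractVal f y (nbr 0F) ⊕ (contractVal f y (nbr 1F) ⊕ contractVal f y (nbr 2F))
        ≡⟨ cong₂ _⊕_ (at-ι 0F) (cong₂ _⊕_ (at-ι 1F) (at-ι 2F)) ⟩
      val f (ι y) (end (nbr 0F) y) ⊕ (val f (ι y) (end (nbr 1F) y) ⊕ val f (ι y) (end (nbr 2F) y))
        ≡⟨ kirchhoff (ι-nbhd y≢v (cubicH y)) f 0F 1F 2F (λ ()) (λ ()) (λ ()) ⟩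
      0z ∎
      where open ≡-Reasoning
            open NeighbourhoodProperties using (Σz-around; kirchhoff)
            open Neighbourhood (cubicH y)
            at-ι : ∀ k → contractVal f y (nbr k) ≡ val f (ι y) (end (nbr k) y)
            at-ι k = contract-at-ι f (nbr k) y≢v

    contract-conserve : ∀ f y → Σz (contractVal f y) ≡ 0z
    contract-conserve f y = by-cases (y ≟ v)
      where
      by-cases : Dec (y ≡ v) → Σz (contractVal f y) ≡ 0z
      by-cases (yes refl) = conserve-at-v f
      by-cases (no y≢v)   = conserve-at-ι f y≢v

    contract : Flow G → Flow H
    contract f = record
      { val      = contractVal f
      ; val-sym  = λ y z → val-sym f (end y z) (end z y)
      ; val-off  = contract-off f
      ; conserve = contract-conserve f
      }

    contractNZ : NZFlow G → NZFlow H
    contractNZ (f , nz) = contract f , λ y z yz → nz _ _ (trans (adj-end y z) yz)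

    pendant-colour : ∀ (F : NZFlow G) i j k → i ≢ j → i ≢ k → j ≢ k →
                     val (proj₁ F) (t i) (t j) ≡ pendant (proj₁ F) k
    pendant-colour F@(f , _) i j k i≢j i≢k j≢k = begin
      val f (t i) (t j)
        ≡⟨ Triangle.triangle-colour cubicG F (adj-t-t (i≢k ∘ sym)) (adj-t-t (j≢k ∘ sym)) (adj-t-t i≢j) ⟩
      val f (t k) (t i) ⊕ val f (t k) (t j)
        ≡⟨ x⊕[y⊕z]≡0⇒x≡y⊕z (pendant f k) (val f (t k) (t i)) (val f (t k) (t j))
             (kirchhoff-at-t f k i j (i≢k ∘ sym) (j≢k ∘ sym) i≢j) ⟨
      pendant f k ∎
      where open ≡-Reasoning

    module _ (F F′ : NZFlow G) where
      private
        f = proj₁ F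
        f′ = proj₁ F′

      PendantsAgree : Set
      PendantsAgree = ∀ l → pendant f l ≡ pendant f′ l

      agree-t⇒pendants : ∀ i → AgreeAt f f′ (t i) → PendantsAgree
      agree-t⇒pendants i agree l with l ≟ i
      ... | yes refl = agree (ι (u l))
      ... | no l≢i with j , j≢l , j≢i ← fin3-third l i =
        trans (sym (pendant-colour F i j l (j≢i ∘ sym) (l≢i ∘ sym) j≢l))
              (trans (agree (t j)) (pendant-colour F′ i j l (j≢i ∘ sym) (l≢i ∘ sym) j≢l))

      pendants⇒agree-t : PendantsAgree → ∀ i → AgreeAt f f′ (t i)
      pendants⇒agree-t pendants i = NeighbourhoodProperties.agree-around (t-nbhd i) f f′ at-corner
        where
        at-corner : ∀ k → val f (t i) (corner i k) ≡ val f′ (t i) (corner i k)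
        at-corner k with k ≟ i
        ... | yes refl = pendants k
        ... | no k≢i with l , l≢i , l≢k ← fin3-third i k =
          trans (pendant-colour F i k l (k≢i ∘ sym) (l≢i ∘ sym) (l≢k ∘ sym))
                (trans (pendants l) (sym (pendant-colour F′ i k l (k≢i ∘ sym) (l≢i ∘ sym) (l≢k ∘ sym))))

      pendants⇒agree-v : PendantsAgree → AgreeAt (contract f) (contract f′) v
      pendants⇒agree-v pendants = NeighbourhoodProperties.agree-around v-nbhd (contract f) (contract f′)
        (λ l → trans (contract-at-v f l) (trans (pendants l) (sym (contract-at-v f′ l))))

      agree-v⇒pendants : AgreeAt (contract f) (contract f′) v → PendantsAgree
      agree-v⇒pendants agree l = trans (sym (contract-at-v f l)) (trans (agree (u l)) (contract-at-v f′ l))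

      agree-ι⇒contract : ∀ {y} → y ≢ v → AgreeAt f f′ (ι y) → AgreeAt (contract f) (contract f′) y
      agree-ι⇒contract y≢v agree z =
        trans (contract-at-ι f z y≢v) (trans (agree _) (sym (contract-at-ι f′ z y≢v)))

      contract⇒agree-ι : ∀ {y} → y ≢ v → AgreeAt (contract f) (contract f′) y → AgreeAt f f′ (ι y)
      contract⇒agree-ι {y} y≢v agree = NeighbourhoodProperties.agree-around (ι-nbhd y≢v (cubicH y)) f f′
        (λ k → trans (sym (contract-at-ι f (nbr k) y≢v))
                     (trans (agree (nbr k)) (contract-at-ι f′ (nbr k) y≢v)))
        where open Neighbourhood (cubicH y)

    rigid-preserved : Rigid H → Rigid G
    rigid-preserved rigidH F F′ w agree-w = agree-everywhere
      where
      F̂ = contractNZ F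
      F̂′ = contractNZ F′
      contracted : F̂ ≈F F̂′
      contracted with cover w
      ... | inj₁ (y , y≢v , refl) = rigidH F̂ F̂′ y (agree-ι⇒contract F F′ y≢v agree-w)
      ... | inj₂ (i , refl)       = rigidH F̂ F̂′ v (pendants⇒agree-v F F′ (agree-t⇒pendants F F′ i agree-w))
      agree-everywhere : ∀ x → AgreeAt (proj₁ F) (proj₁ F′) x
      agree-everywhere x with cover x
      ... | inj₁ (y , y≢v , refl) = contract⇒agree-ι F F′ y≢v (contracted y)
      ... | inj₂ (i , refl)       = pendants⇒agree-t F F′ (agree-v⇒pendants F F′ (contracted v)) i

    module _ (F : NZFlow G) (c : Z22) where
      private
        S = kempeEdges (proj₁ F) c

      triangle-joined : ∀ i j → Walk S (t i) (t j)
      triangle-joined i j with i ≟ j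
      ... | yes refl = here
      ... | no i≢j with k , k≢i , k≢j ← fin3-third i j =
        Triangle.triangle-walk cubicG F c (adj-t-t i≢j) (adj-t-t (k≢i ∘ sym)) (adj-t-t (k≢j ∘ sym))

      ends-joined : ∀ y a b → Walk S (end y a) (end y b)
      ends-joined y a b with y ≟ v
      ... | yes _ = triangle-joined (position a) (position b)
      ... | no _  = here

      lift : ∀ {y z} a b → Walk (kempeEdges (contract (proj₁ F)) c) y z → Walk S (end y a) (end z b)
      lift {y} a b here                 = ends-joined y a b
      lift {y} a b (step {y = y′} s p) = ends-joined y a y′ ++ step s (lift y b p)

    kempe-connected-preserved : KempeConnected H → KempeConnected G
    kempe-connected-preserved connectedH F c w w′
      with y , a , refl ← end-covers w | y′ , b , refl ← end-covers w′ =
      lift F c a b (connectedH (contractNZ F) c y y′)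

  properties-preserved : KleeProperties H → KleeProperties G
  properties-preserved P = record
    { cubic           = cubicG
    ; rigid           = rigid-preserved rigid
    ; kempe-connected = kempe-connected-preserved kempe-connected
    }
    where
    open KleeProperties P
    open Contraction cubic


klee-properties : ∀ {n} {G : Graph n} → IsKlee G → KleeProperties G
klee-properties (k4 G refl complete) = K4.properties G complete
klee-properties (trunc K v T)        = Truncate.properties-preserved T (klee-properties K)

corollary4p5 : ∀ {n} (G : Graph n) → IsKlee G → FlowGraphConnected G
corollary4p5 G K = flowGraph-connected (klee-properties K)
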